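{- For positive integers $b\ge2$ and $s$, we have $M_s(b)\le b^{\log_2\log_2 b}$.
   Context: $M_s(b)$ denotes the number of $s$-tuples $(d_1,\dots,d_s)$ of positive integers with $d_1\ge d_2\ge\cdots\ge d_s\ge1$ and $d_1\cdots d_s=b$ (equivalently, the number of unordered factorizations of $b$ into at most $s$ factors greater than $1$). -}

module Defs where

open import Data.Bool using (Bool; true; false; _∧_)
open import Data.Nat using (ℕ; zero; suc; _*_; _≤ᵇ_; _≡ᵇ_)
open import Data.List using (List; []; _∷_; [_]; map; concatMap; upTo; filterᵇ; length)
open import Data.Vec using (Vec; []; _∷_)

vecsUpTo : (s b : ℕ) → List (Vec ℕ s)
vecsUpTo zero    b = [ [] ]
vecsUpTo (suc s) b = concatMap (λ d → map (d ∷_) (vecsUpTo s b)) (map suc (upTo b))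

vprod : ∀ {n} → Vec ℕ n → ℕ
vprod []       = 1
vprod (x ∷ xs) = x * vprod xs

nonincreasing : ∀ {n} → Vec ℕ n → Bool
nonincreasing []           = true
nonincreasing (x ∷ [])     = true
nonincreasing (x ∷ y ∷ xs) = (y ≤ᵇ x) ∧ nonincreasing (y ∷ xs)

-- Since b ≥ 1 forces every dᵢ ≤ b
-- (for b = 0 there are none), enumerating entries in {1,…,b} is exhaustive.
M : (s b : ℕ) → ℕ
M s b = length (filterᵇ (λ v → nonincreasing v ∧ (vprod v ≡ᵇ b)) (vecsUpTo s b))

{-# OPTIONS --safe #-}
-- Removing the largest entry d from a nonincreasing factorization of k leaves a nonincreasing
-- factorization of k / d with entries at most d, and d = 1 forces k = 1.  Hence every g with
-- g 1 ≥ 1 and g k ≥ Σ_{d ∣ k, d ≥ 2} g (k / d) for k ≥ 2 bounds M s k, whatever s is.  One such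
-- g is the number of ordered factorizations below 16 and k² from 16 on, because
-- Σ_{d ≥ 2} (k / d)² ≤ k² Σ_{d ≥ 2} (1 / (d − 1) − 1 / d) = k².  Writing L = p / q ≥ log₂ b,
-- this gives M s b ≤ L ^ L: for b < 16 since g b ≤ j ^ j with j = ⌊log₂ b⌋ ≤ L, and for b ≥ 16
-- since b² ≤ 4 ^ L ≤ L ^ L.
module Submission where

open import Defs
open import Data.Nat using (ℕ; zero; suc; _+_; _*_; _^_; _/_; _≤_; _<_; z≤n; s≤s; _≡ᵇ_; _≤ᵇ_; >-nonZero)
open import Data.Nat.Properties
open import Data.Nat.DivMod using (m*n/n≡m; n/1≡n; m≥n⇒m/n>0; /-monoʳ-≤; /-monoˡ-≤)
open import Data.Nat.Divisibility using (divides; _∣?_; ∣⇒≤)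
open import Data.Nat.Logarithm using (⌊log₂_⌋)
open import Data.Nat.ListAction using (sum)
open import Data.Nat.Tactic.RingSolver using (solve-∀)
open import Data.Bool using (Bool; true; false; _∧_; T)
open import Data.Bool.Properties using (T-∧)
open import Data.Empty using (⊥-elim)
open import Data.Product using (_×_; _,_; proj₂)
open import Data.Sum using (inj₁; inj₂)
open import Data.List using (List; []; _∷_; _++_; map; concatMap; upTo; applyUpTo; filterᵇ; length)
open import Data.List.Properties using (filter-++; filter-none; length-++; map-cong; map-applyUpTo)
open import Data.List.Relation.Unary.All using (universal)
open import Data.Vec using (Vec; []; _∷_)
open import Function using (_∘_)
open import Function.Bundles using (Equivalence)
open import Relation.Binary.PropositionalEquality
open import Relation.Nullary using (yes; no; ¬_)
open import Relation.Nullary.Decidable using (T?; from-yes; _×-dec_; _→-dec_)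

count : {A : Set} → (A → Bool) → List A → ℕ
count p xs = length (filterᵇ p xs)

private
  variable
    A B : Set

count-++ : ∀ (p : A → Bool) xs ys → count p (xs ++ ys) ≡ count p xs + count p ys
count-++ p xs ys = trans (cong length (filter-++ (T? ∘ p) xs ys)) (length-++ (filterᵇ p xs))

count-map : ∀ (p : B → Bool) (f : A → B) xs → count p (map f xs) ≡ count (p ∘ f) xs
count-map p f [] = refl
count-map p f (x ∷ xs) with p (f x)
... | true  = cong suc (count-map p f xs)
... | false = count-map p f xs

count-concatMap : ∀ (p : B → Bool) (f : A → List B) xs →
                  count p (concatMap f xs) ≡ sum (map (count p ∘ f) xs)
count-concatMap p f []       = refl
count-concatMap p f (x ∷ xs) =
  trans (count-++ p (f x) (concatMap f xs)) (cong (count p (f x) +_) (count-concatMap p f xs))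

count-mono : ∀ {p r : A → Bool} → (∀ x → T (p x) → T (r x)) → ∀ xs → count p xs ≤ count r xs
count-mono p⇒r [] = z≤n
count-mono {p = p} {r = r} p⇒r (x ∷ xs) with p x | r x | p⇒r x
... | true  | true  | _   = s≤s (count-mono p⇒r xs)
... | true  | false | p⇒⊥ = ⊥-elim (p⇒⊥ _)
... | false | true  | _   = m≤n⇒m≤1+n (count-mono p⇒r xs)
... | false | false | _   = count-mono p⇒r xs

count-none : ∀ {p : A → Bool} → (∀ x → ¬ T (p x)) → ∀ xs → count p xs ≡ 0
count-none {p = p} ¬p xs = cong length (filter-none (T? ∘ p) (universal ¬p xs))

∧-mapʳ : ∀ a {b c} → (T b → T c) → T (a ∧ b) → T (a ∧ c)
∧-mapʳ true b⇒c = b⇒c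

sumFrom : (ℕ → ℕ) → ℕ → ℕ → ℕ
sumFrom f a zero    = 0
sumFrom f a (suc n) = f a + sumFrom f (suc a) n

sum-map-applyUpTo : ∀ h g a n → (∀ i → g i ≡ a + i) → sum (map h (applyUpTo g n)) ≡ sumFrom h a n
sum-map-applyUpTo h g a zero    g≗a+ = refl
sum-map-applyUpTo h g a (suc n) g≗a+ = cong₂ _+_
  (cong h (trans (g≗a+ 0) (+-identityʳ a)))
  (sum-map-applyUpTo h (g ∘ suc) (suc a) n (λ i → trans (g≗a+ (suc i)) (+-suc a i)))

sumFrom-mono : ∀ {f h} a n → (∀ d → a ≤ d → f d ≤ h d) → sumFrom f a n ≤ sumFrom h a n
sumFrom-mono a zero    f≤h = z≤n
sumFrom-mono a (suc n) f≤h =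
  +-mono-≤ (f≤h a ≤-refl) (sumFrom-mono (suc a) n (λ d a<d → f≤h d (<⇒≤ a<d)))

sumFrom-+ : ∀ f a m n → sumFrom f a (m + n) ≡ sumFrom f a m + sumFrom f (a + m) n
sumFrom-+ f a zero    n = cong (λ a′ → sumFrom f a′ n) (sym (+-identityʳ a))
sumFrom-+ f a (suc m) n = begin
  f a + sumFrom f (suc a) (m + n)                       ≡⟨ cong (f a +_) (sumFrom-+ f (suc a) m n) ⟩
  f a + (sumFrom f (suc a) m + sumFrom f (suc a + m) n) ≡⟨ sym (+-assoc (f a) _ _) ⟩
  f a + sumFrom f (suc a) m + sumFrom f (suc a + m) n   ≡⟨ cong (λ a′ → f a + sumFrom f (suc a) m + sumFrom f a′ n) (+-suc a m) ⟨
  f a + sumFrom f (suc a) m + sumFrom f (a + suc m) n   ∎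
  where open ≡-Reasoning

sumFrom-vanishes : ∀ {f} a n → (∀ d → a ≤ d → f d ≡ 0) → sumFrom f a n ≡ 0
sumFrom-vanishes a zero    f≡0 = refl
sumFrom-vanishes a (suc n) f≡0 =
  cong₂ _+_ (f≡0 a ≤-refl) (sumFrom-vanishes (suc a) n (λ d a<d → f≡0 d (<⇒≤ a<d)))

sumFrom-saturates : ∀ {f} a m n → (∀ d → a + m ≤ d → f d ≡ 0) → sumFrom f a n ≤ sumFrom f a m
sumFrom-saturates {f} a m n f≡0 with ≤-total m n
... | inj₁ m≤n with o , refl ← m≤n⇒∃[o]m+o≡n m≤n = ≤-reflexive (begin
  sumFrom f a (m + o)                      ≡⟨ sumFrom-+ f a m o ⟩
  sumFrom f a m + sumFrom f (a + m) o      ≡⟨ cong (sumFrom f a m +_) (sumFrom-vanishes (a + m) o f≡0) ⟩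
  sumFrom f a m + 0                        ≡⟨ +-identityʳ _ ⟩
  sumFrom f a m                            ∎)
  where open ≡-Reasoning
... | inj₂ n≤m with o , refl ← m≤n⇒∃[o]m+o≡n n≤m =
  subst (sumFrom f a n ≤_) (sym (sumFrom-+ f a n o)) (m≤m+n _ _)

divTerm : (ℕ → ℕ) → ℕ → ℕ → ℕ
divTerm f k zero = 0
divTerm f k d@(suc _) with d ∣? k
... | yes _ = f (k / d)
... | no _  = 0

divTerm-mono : ∀ {f h k} d → 1 ≤ k → (∀ j → 1 ≤ j → f j ≤ h j) → divTerm f k d ≤ divTerm h k d
divTerm-mono zero          _   f≤h = z≤n
divTerm-mono {k = k} d@(suc _) 1≤k f≤h with d ∣? k
... | yes d∣k = f≤h (k / d) (m≥n⇒m/n>0 (∣⇒≤ {{>-nonZero 1≤k}} d∣k))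
... | no _    = z≤n

divTerm-vanishes : ∀ {f k} d → 1 ≤ k → k < d → divTerm f k d ≡ 0
divTerm-vanishes {k = k} d@(suc _) 1≤k k<d with d ∣? k
... | yes d∣k = ⊥-elim (<⇒≱ k<d (∣⇒≤ {{>-nonZero 1≤k}} d∣k))
... | no _    = refl

-- With f j ≤ j², the term at d = c + 2 is at most (k/d)² ≤ k²/(c+1) − k²/(c+2).
divTerm-telescopes : ∀ {f} → (∀ j → f j ≤ j * j) → ∀ k c →
                     divTerm f k (2 + c) + k * k / (2 + c) ≤ k * k / suc c
divTerm-telescopes {f} f≤sq k c with 2 + c ∣? k
... | no _ = /-monoʳ-≤ (k * k) (n≤1+n (suc c))
... | yes (divides j refl) = begin
  f (j * d / d) + j * d * (j * d) / d        ≡⟨ cong₂ (λ x y → f x + y / d) (m*n/n≡m j d) (square j d) ⟩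
  f j + j * j * d * d / d                    ≡⟨ cong (f j +_) (m*n/n≡m (j * j * d) d) ⟩
  f j + j * j * d                            ≤⟨ +-monoˡ-≤ (j * j * d) (f≤sq j) ⟩
  j * j + j * j * d                          ≡⟨ collect j c ⟩
  j * j * (3 + c)                            ≡⟨ sym (m*n/n≡m (j * j * (3 + c)) (suc c)) ⟩
  j * j * (3 + c) * suc c / suc c            ≤⟨ /-monoˡ-≤ (suc c) (m≤m+n (j * j * (3 + c) * suc c) (j * j)) ⟩
  (j * j * (3 + c) * suc c + j * j) / suc c  ≡⟨ cong (_/ suc c) (sym (expand j c)) ⟩
  j * d * (j * d) / suc c                    ∎
  where
  open ≤-Reasoning
  d = 2 + c
  square : ∀ j d → j * d * (j * d) ≡ j * j * d * d
  square = solve-∀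
  collect : ∀ j c → j * j + j * j * (2 + c) ≡ j * j * (3 + c)
  collect = solve-∀
  expand : ∀ j c → j * (2 + c) * (j * (2 + c)) ≡ j * j * (3 + c) * suc c + j * j
  expand = solve-∀

sumFrom-divTerm-≤ : ∀ {f} → (∀ j → f j ≤ j * j) → ∀ k c n →
                      sumFrom (divTerm f k) (2 + c) n ≤ k * k / suc c
sumFrom-divTerm-≤ f≤sq k c zero    = z≤n
sumFrom-divTerm-≤ {f} f≤sq k c (suc n) = begin
  divTerm f k (2 + c) + sumFrom (divTerm f k) (3 + c) n ≤⟨ +-monoʳ-≤ _ (sumFrom-divTerm-≤ f≤sq k (suc c) n) ⟩
  divTerm f k (2 + c) + k * k / (2 + c)                 ≤⟨ divTerm-telescopes f≤sq k c ⟩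
  k * k / suc c                                         ∎
  where open ≤-Reasoning

M′ : (s n m k : ℕ) → ℕ
M′ s n m k = count (λ v → nonincreasing (m ∷ v) ∧ (vprod v ≡ᵇ k)) (vecsUpTo s n)

slice : (s n k d : ℕ) → ℕ
slice s n k d = count (λ v → nonincreasing (d ∷ v) ∧ (d * vprod v ≡ᵇ k)) (vecsUpTo s n)

count-vecsUpTo-suc : ∀ s n (P : Vec ℕ (suc s) → Bool) →
                     count P (vecsUpTo (suc s) n) ≡ sumFrom (λ d → count (P ∘ (d ∷_)) (vecsUpTo s n)) 1 n
count-vecsUpTo-suc s n P = begin
  count P (concatMap (λ d → map (d ∷_) (vecsUpTo s n)) (map suc (upTo n)))
    ≡⟨ count-concatMap P (λ d → map (d ∷_) (vecsUpTo s n)) (map suc (upTo n)) ⟩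
  sum (map (λ d → count P (map (d ∷_) (vecsUpTo s n))) (map suc (upTo n)))
    ≡⟨ cong sum (map-cong (λ d → count-map P (d ∷_) (vecsUpTo s n)) (map suc (upTo n))) ⟩
  sum (map sliceAt (map suc (upTo n)))
    ≡⟨ cong (sum ∘ map sliceAt) (map-applyUpTo (λ i → i) suc n) ⟩
  sum (map sliceAt (applyUpTo suc n))
    ≡⟨ sum-map-applyUpTo sliceAt suc 1 n (λ _ → refl) ⟩
  sumFrom sliceAt 1 n ∎
  where
  open ≡-Reasoning
  sliceAt : ℕ → ℕ
  sliceAt d = count (P ∘ (d ∷_)) (vecsUpTo s n)

M-suc : ∀ s b → M (suc s) b ≡ sumFrom (slice s b b) 1 b
M-suc s b = count-vecsUpTo-suc s b _

M′-suc-≤ : ∀ s n m k → M′ (suc s) n m k ≤ sumFrom (slice s n k) 1 n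
M′-suc-≤ s n m k = ≤-trans (≤-reflexive (count-vecsUpTo-suc s n _))
  (sumFrom-mono 1 n (λ d _ → count-mono (λ v → T-∧-dropˡ (d ≤ᵇ m) _ _) (vecsUpTo s n)))
  where
  T-∧-dropˡ : ∀ a b c → T ((a ∧ b) ∧ c) → T (b ∧ c)
  T-∧-dropˡ true b c t = t

vprod-≤1 : ∀ {s} (v : Vec ℕ s) → T (nonincreasing (1 ∷ v)) → vprod v ≤ 1
vprod-≤1 []                  _ = ≤-refl
vprod-≤1 (0 ∷ v)             _ = z≤n
vprod-≤1 (1 ∷ v)             t = subst (_≤ 1) (sym (+-identityʳ (vprod v))) (vprod-≤1 v t)
vprod-≤1 (suc (suc _) ∷ v)   ()

slice-one : ∀ s n → slice s n 1 1 ≤ M′ s n 1 1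
slice-one s n = count-mono
  (λ v → ∧-mapʳ (nonincreasing (1 ∷ v)) (subst (λ x → T (x ≡ᵇ 1)) (*-identityˡ (vprod v))))
  (vecsUpTo s n)

slice-one-vanishes : ∀ s n k → 2 ≤ k → slice s n k 1 ≡ 0
slice-one-vanishes s n k 2≤k = count-none ¬counted (vecsUpTo s n)
  where
  ¬counted : ∀ v → ¬ T (nonincreasing (1 ∷ v) ∧ (1 * vprod v ≡ᵇ k))
  ¬counted v t with Equivalence.to (T-∧ {nonincreasing (1 ∷ v)}) t
  ... | noninc , prod≡k = <⇒≱ 2≤k (begin
    k              ≡⟨ sym (≡ᵇ⇒≡ (1 * vprod v) k prod≡k) ⟩
    1 * vprod v    ≡⟨ *-identityˡ (vprod v) ⟩
    vprod v        ≤⟨ vprod-≤1 v noninc ⟩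
    1              ∎)
    where open ≤-Reasoning

slice-≤-divTerm : ∀ s n k d → slice s n k (suc d) ≤ divTerm (M′ s n (suc d)) k (suc d)
slice-≤-divTerm s n k d with suc d ∣? k
... | yes (divides j refl) = count-mono
  (λ v → ∧-mapʳ (nonincreasing (suc d ∷ v)) λ t → ≡⇒≡ᵇ (vprod v) (j * suc d / suc d) (begin
    vprod v              ≡⟨ *-cancelˡ-≡ (vprod v) j (suc d) (trans (≡ᵇ⇒≡ _ _ t) (*-comm j (suc d))) ⟩
    j                    ≡⟨ m*n/n≡m j (suc d) ⟨
    j * suc d / suc d    ∎))
  (vecsUpTo s n)
  where open ≡-Reasoning
... | no d∤k = ≤-reflexive (count-none ¬counted (vecsUpTo s n))
  where
  ¬counted : ∀ v → ¬ T (nonincreasing (suc d ∷ v) ∧ (suc d * vprod v ≡ᵇ k))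
  ¬counted v t = d∤k (divides (vprod v)
    (trans (sym (≡ᵇ⇒≡ _ _ (proj₂ (Equivalence.to (T-∧ {nonincreasing (suc d ∷ v)}) t))))
           (*-comm (suc d) (vprod v))))

-- The recursion h 1 = 1, h k = Σ_{d ∣ k, d ≥ 2} h (k / d) counts ordered factorizations.
record Supersolution (g : ℕ → ℕ) : Set where
  field
    at-one : 1 ≤ g 1
    step   : ∀ k n → 2 ≤ k → sumFrom (divTerm g k) 2 n ≤ g k

module _ {g : ℕ → ℕ} (sup : Supersolution g) where
  open Supersolution sup

  sumFrom-slice-≤ : ∀ s n → (∀ m k → 1 ≤ k → M′ s n m k ≤ g k) →
                    ∀ k → 1 ≤ k → sumFrom (slice s n k) 1 n ≤ g k
  sumFrom-slice-≤ s zero    M′≤g k _   = z≤n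
  sumFrom-slice-≤ s (suc n) M′≤g k 1≤k = ≤-trans (+-monoʳ-≤ (slice s (suc n) k 1) tail≤) (head+tail≤ k 1≤k)
    where
    tail≤ : sumFrom (slice s (suc n) k) 2 n ≤ sumFrom (divTerm g k) 2 n
    tail≤ = sumFrom-mono 2 n λ where
      (suc d) _ → ≤-trans (slice-≤-divTerm s (suc n) k d) (divTerm-mono (suc d) 1≤k (M′≤g (suc d)))
    head+tail≤ : ∀ k → 1 ≤ k → slice s (suc n) k 1 + sumFrom (divTerm g k) 2 n ≤ g k
    head+tail≤ 1 _ = begin
      slice s (suc n) 1 1 + sumFrom (divTerm g 1) 2 n ≡⟨ cong (slice s (suc n) 1 1 +_)
                                                            (sumFrom-vanishes 2 n λ d → divTerm-vanishes d ≤-refl) ⟩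
      slice s (suc n) 1 1 + 0                          ≡⟨ +-identityʳ _ ⟩
      slice s (suc n) 1 1                              ≤⟨ slice-one s (suc n) ⟩
      M′ s (suc n) 1 1                                 ≤⟨ M′≤g 1 1 ≤-refl ⟩
      g 1                                              ∎
      where open ≤-Reasoning
    head+tail≤ k@(suc (suc _)) _ rewrite slice-one-vanishes s (suc n) k (s≤s (s≤s z≤n)) =
      step k n (s≤s (s≤s z≤n))

  M′-≤ : ∀ s n m k → 1 ≤ k → M′ s n m k ≤ g k
  M′-≤ zero    n m 1             _   = at-one
  M′-≤ zero    n m (suc (suc k)) _   = z≤n
  M′-≤ (suc s) n m k             1≤k = ≤-trans (M′-suc-≤ s n m k) (sumFrom-slice-≤ s n (M′-≤ s n) k 1≤k)

  M-≤ : ∀ s b → 1 ≤ s → 1 ≤ b → M s b ≤ g b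
  M-≤ (suc s) b _ 1≤b = ≤-trans (≤-reflexive (M-suc s b)) (sumFrom-slice-≤ s b (M′-≤ s b) b 1≤b)

-- Below 16 this is the number of ordered factorizations of k, the least supersolution.
majorant : ℕ → ℕ
majorant 1  = 1
majorant 2  = 1
majorant 3  = 1
majorant 4  = 2
majorant 5  = 1
majorant 6  = 3
majorant 7  = 1
majorant 8  = 4
majorant 9  = 2
majorant 10 = 3
majorant 11 = 1
majorant 12 = 8
majorant 13 = 1
majorant 14 = 3
majorant 15 = 3
majorant k  = k * k

majorant-≥16 : ∀ {k} → 16 ≤ k → majorant k ≡ k * k
majorant-≥16 16≤k = subst (λ k → majorant k ≡ k * k) (m+[n∸m]≡n 16≤k) refl

majorant-≤-square : ∀ k → majorant k ≤ k * k
majorant-≤-square k with k <? 16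
... | yes k<16 = from-yes (allUpTo? (λ k → majorant k ≤? k * k) 16) k<16
... | no k≮16  = ≤-reflexive (majorant-≥16 (≮⇒≥ k≮16))

majorant-supersolution : Supersolution majorant
majorant-supersolution = record { at-one = ≤-refl ; step = step }
  where
  step : ∀ k n → 2 ≤ k → sumFrom (divTerm majorant k) 2 n ≤ majorant k
  step k n 2≤k with k <? 16
  ... | yes k<16 = ≤-trans
    (sumFrom-saturates 2 14 n λ d 16≤d → divTerm-vanishes d (<⇒≤ 2≤k) (<-≤-trans k<16 16≤d))
    (from-yes (allUpTo? (λ k → 2 ≤? k →-dec sumFrom (divTerm majorant k) 2 14 ≤? majorant k) 16) k<16 2≤k)
  ... | no k≮16 = begin
    sumFrom (divTerm majorant k) 2 n ≤⟨ sumFrom-divTerm-≤ majorant-≤-square k 0 n ⟩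
    k * k / 1                        ≡⟨ n/1≡n (k * k) ⟩
    k * k                            ≡⟨ majorant-≥16 (≮⇒≥ k≮16) ⟨
    majorant k                       ∎
    where open ≤-Reasoning

^-distribʳ-* : ∀ m n o → (m * n) ^ o ≡ m ^ o * n ^ o
^-distribʳ-* m n zero    = refl
^-distribʳ-* m n (suc o) = trans (cong (m * n *_) (^-distribʳ-* m n o)) ([m*n]*[o*p]≡[m*o]*[n*p] m n (m ^ o) (n ^ o))

2^j≤b⇒j*q≤p : ∀ j b p q → 2 ^ j ≤ b → b ^ q ≤ 2 ^ p → j * q ≤ p
2^j≤b⇒j*q≤p j b p q 2^j≤b b^q≤2^p = ≮⇒≥ λ p<j*q → <⇒≱ (^-monoʳ-< 2 (s≤s (s≤s z≤n)) p<j*q) (begin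
  2 ^ (j * q)    ≡⟨ ^-*-assoc 2 j q ⟨
  (2 ^ j) ^ q    ≤⟨ ^-monoˡ-≤ q 2^j≤b ⟩
  b ^ q          ≤⟨ b^q≤2^p ⟩
  2 ^ p          ∎)
  where open ≤-Reasoning

c^q≤j^p⇒c^q*q^p≤p^p : ∀ c j p q → c ^ q ≤ j ^ p → j * q ≤ p → c ^ q * q ^ p ≤ p ^ p
c^q≤j^p⇒c^q*q^p≤p^p c j p q c^q≤j^p j*q≤p = begin
  c ^ q * q ^ p  ≤⟨ *-monoˡ-≤ (q ^ p) c^q≤j^p ⟩
  j ^ p * q ^ p  ≡⟨ ^-distribʳ-* j q p ⟨
  (j * q) ^ p    ≤⟨ ^-monoˡ-≤ p j*q≤p ⟩
  p ^ p          ∎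
  where open ≤-Reasoning

majorant-≤-log₂^log₂ : ∀ {b} → b < 16 → 2 ≤ b →
                       1 ≤ ⌊log₂ b ⌋ × 2 ^ ⌊log₂ b ⌋ ≤ b × majorant b ≤ ⌊log₂ b ⌋ ^ ⌊log₂ b ⌋
majorant-≤-log₂^log₂ = from-yes (allUpTo? (λ b → 2 ≤? b →-dec
  (1 ≤? ⌊log₂ b ⌋ ×-dec 2 ^ ⌊log₂ b ⌋ ≤? b ×-dec majorant b ≤? ⌊log₂ b ⌋ ^ ⌊log₂ b ⌋)) 16)

majorant-bound : ∀ b p q → 2 ≤ b → b ^ q ≤ 2 ^ p → majorant b ^ q * q ^ p ≤ p ^ p
majorant-bound b p q 2≤b b^q≤2^p with b <? 16
... | yes b<16 with 1≤j , 2^j≤b , g≤j^j ← majorant-≤-log₂^log₂ b<16 2≤b =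
  c^q≤j^p⇒c^q*q^p≤p^p (majorant b) j p q (begin
    majorant b ^ q  ≤⟨ ^-monoˡ-≤ q g≤j^j ⟩
    (j ^ j) ^ q     ≡⟨ ^-*-assoc j j q ⟩
    j ^ (j * q)     ≤⟨ ^-monoʳ-≤ j {{>-nonZero 1≤j}} j*q≤p ⟩
    j ^ p           ∎) j*q≤p
  where
  open ≤-Reasoning
  j = ⌊log₂ b ⌋
  j*q≤p = 2^j≤b⇒j*q≤p j b p q 2^j≤b b^q≤2^p
... | no b≮16 = c^q≤j^p⇒c^q*q^p≤p^p (majorant b) 4 p q (begin
    majorant b ^ q  ≡⟨ cong (_^ q) (majorant-≥16 16≤b) ⟩
    (b * b) ^ q     ≡⟨ ^-distribʳ-* b b q ⟩
    b ^ q * b ^ q   ≤⟨ *-mono-≤ b^q≤2^p b^q≤2^p ⟩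
    2 ^ p * 2 ^ p   ≡⟨ ^-distribʳ-* 2 2 p ⟨
    4 ^ p           ∎) (2^j≤b⇒j*q≤p 4 b p q 16≤b b^q≤2^p)
  where
  open ≤-Reasoning
  16≤b = ≮⇒≥ b≮16

lemma5p4 : (b s : ℕ) → 2 ≤ b → 1 ≤ s →
    (p q : ℕ) → 1 ≤ q → b ^ q ≤ 2 ^ p →
    (M s b) ^ q * q ^ p ≤ p ^ p
lemma5p4 b s 2≤b 1≤s p q _ b^q≤2^p = begin
  M s b ^ q * q ^ p        ≤⟨ *-monoˡ-≤ (q ^ p) (^-monoˡ-≤ q M≤majorant) ⟩
  majorant b ^ q * q ^ p   ≤⟨ majorant-bound b p q 2≤b b^q≤2^p ⟩
  p ^ p                    ∎
  where
  open ≤-Reasoning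
  M≤majorant : M s b ≤ majorant b
  M≤majorant = M-≤ majorant-supersolution s b 1≤s (<⇒≤ 2≤b)
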